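{- Let $n\ge 0$, let $P_{n+1}$ be the path with vertices $v_0,\dots,v_n$ and edges $v_iv_{i+1}$, let $w:\{v_0,\dots,v_n\}\to\mathbb{N}$ be a weight function, and let $L^c$ be a waterfall list of $P_{n+1}$. Then $P_{n+1}$ is $(L^c,w)$-colorable if and only if for all $i,j\in\{0,\dots,n\}$ with $i\le j$, $$\Big|\bigcup_{k=i}^{j}L^c(k)\Big|\ \ge\ \sum_{k=i}^{j}w(k).$$
   Context: A list $L$ assigns to each vertex a finite subset of $\mathbb{N}$; write $L(i)=L(v_i)$, $w(i)=w(v_i)$. An $(L,w)$-coloring is a map $c$ with $c(v)\subseteq L(v)$, $|c(v)|=w(v)$ for each vertex $v$, and $c(v)\cap c(v')=\emptyset$ for each edge $vv'$; the graph is $(L,w)$-colorable if one exists. A list $L$ of $P_{n+1}$ is a waterfall list if $L(i)\cap L(j)=\emptyset$ whenever $|i-j|\ge 2$. -}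

module Defs where

open import Data.Nat using (ℕ; suc; _≤_; _≤?_; ∣_-_∣; _≟_)
open import Data.Fin using (Fin; toℕ; inject₁)
import Data.Fin as F
open import Data.List using (List; length; filter; allFin; concatMap; map; deduplicate)
open import Data.Nat.ListAction using (sum)
open import Relation.Binary.PropositionalEquality using (_≡_)
open import Data.List.Membership.Propositional using (_∈_)
open import Data.List.Relation.Unary.All using (All)
open import Data.List.Relation.Unary.Unique.Propositional using (Unique)
open import Data.Product using (_×_; Σ)
open import Relation.Nullary using (¬_)
open import Relation.Nullary.Decidable using (_×-dec_)

-- A finite subset of ℕ is represented by a list of naturals (the set of its
-- elements; repetitions are irrelevant).  Its cardinality is the length of the
-- deduplicated list.
FinSet : Set
FinSet = List ℕ

card : FinSet → ℕ
card A = length (deduplicate _≟_ A)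

Disjoint : FinSet → FinSet → Set
Disjoint A B = ∀ x → x ∈ A → ¬ (x ∈ B)

ListAssign : ℕ → Set
ListAssign n = Fin (suc n) → FinSet

Weight : ℕ → Set
Weight n = Fin (suc n) → ℕ

Waterfall : (n : ℕ) → ListAssign n → Set
Waterfall n L = ∀ (i j : Fin (suc n)) → 2 ≤ ∣ toℕ i - toℕ j ∣ → Disjoint (L i) (L j)

IsColoring : (n : ℕ) → ListAssign n → Weight n → (Fin (suc n) → FinSet) → Set
IsColoring n L w c =
  (∀ v → All (_∈ L v) (c v)) ×
  (∀ v → Unique (c v)) ×
  (∀ v → length (c v) ≡ w v) ×
  (∀ (i : Fin n) → Disjoint (c (inject₁ i)) (c (F.suc i)))

PathColorable : (n : ℕ) → ListAssign n → Weight n → Set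
PathColorable n L w = Σ (Fin (suc n) → FinSet) (IsColoring n L w)

range : (n : ℕ) → Fin (suc n) → Fin (suc n) → List (Fin (suc n))
range n i j = filter (λ k → (toℕ i ≤? toℕ k) ×-dec (toℕ k ≤? toℕ j)) (allFin (suc n))

unionCard : (n : ℕ) → ListAssign n → Fin (suc n) → Fin (suc n) → ℕ
unionCard n L i j = card (concatMap L (range n i j))

weightSum : (n : ℕ) → Weight n → Fin (suc n) → Fin (suc n) → ℕ
weightSum n w i j = sum (map w (range n i j))

-- Necessity: the colour sets of a coloring are pairwise disjoint, adjacent ones by the
-- definition of a coloring and the others because they lie in disjoint lists.  So the colour
-- sets of v_i, …, v_j form a duplicate-free list of length ∑ w(k) inside ⋃ L(k).
--
-- Sufficiency holds for every list, waterfall or not.  Colour v_0 with w(v_0) colours of L(v_0),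
-- taking those outside L(v_1) first: then the chosen colours either avoid L(v_1) or contain all
-- of L(v_0) ∖ L(v_1).  Delete them from L(v_1) and colour v_1, …, v_n recursively.  In the first
-- case the interval conditions of the shorter path are inherited directly; in the second, the
-- chosen colours together with the new union over v_1, …, v_j cover the old union over
-- v_0, …, v_j, so the condition for that interval gives the one for v_1, …, v_j.
module Submission where

open import Defs
open import Data.Bool using (true; false)
open import Data.Fin using (Fin; toℕ; inject₁) renaming (zero to fz; suc to fs)
open import Data.Fin.Properties using (toℕ-injective; toℕ-inject₁)
open import Data.List using (List; []; _∷_; _++_; length; filter; allFin; concatMap; map; deduplicate; take)
open import Data.List.Properties using (length-++; length-take; take++drop≡id; map-∘; map-tabulate; map-cong; filter-accept; filter-reject; filter-≐; filter-notAll)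
open import Data.List.Membership.Propositional using (_∈_; _∉_; find; lose)
open import Data.List.Membership.Propositional.Properties using (∈-++⁺ˡ; ∈-++⁺ʳ; ∈-++⁻; ∈-filter⁺; ∈-filter⁻; ∈-allFin; ∈-deduplicate⁺; ∈-deduplicate⁻; ∈-concatMap⁺; ∈-concatMap⁻)
open import Data.List.Relation.Binary.Subset.Propositional using (_⊆_)
open import Data.List.Relation.Unary.Any using (here; there)
open import Data.List.Relation.Unary.All as All using (All)
import Data.List.Relation.Unary.AllPairs as AllPairs
import Data.List.Relation.Unary.AllPairs.Properties as AllPairsₚ
import Data.List.Relation.Unary.All.Properties as Allₚ
open import Data.List.Relation.Unary.Unique.Propositional using (Unique; _∷_)
open import Data.List.Relation.Unary.Unique.Propositional.Properties using (++⁺; take⁺; filter⁺; allFin⁺; concat⁺)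
open import Data.Nat using (ℕ; zero; suc; _+_; _≤_; _≥_; z≤n; s≤s; s≤s⁻¹; _≟_; _≤?_; ∣_-_∣)
open import Data.Nat.ListAction using (sum)
open import Data.List.Membership.DecPropositional _≟_ using (_∈?_)
open import Data.List.Relation.Unary.Unique.DecPropositional.Properties _≟_ using (deduplicate-!)
open import Data.Nat.Properties using (≤-refl; ≤-trans; ≤-antisym; ≤-reflexive; m≤m+n; m≤n+m; m≤n⇒m⊓n≡m; +-cancelˡ-≤; suc-injective; module ≤-Reasoning)
open import Data.Product using (_×_; _,_; proj₁; proj₂; ∃)
open import Data.Sum using (_⊎_; inj₁; inj₂)
open import Function using (_∘_; id)
open import Function.Bundles using (_⇔_; mk⇔)
open import Relation.Nullary using (yes; no; does)
open import Relation.Nullary.Decidable using (¬?; _×-dec_; decidable-stable)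
open import Relation.Unary using (Decidable)
open import Relation.Binary.PropositionalEquality using (_≡_; _≢_; refl; sym; trans; cong; subst; module ≡-Reasoning)

unique-⊆⇒length≤ : {xs ys : List ℕ} → Unique xs → xs ⊆ ys → length xs ≤ length ys
unique-⊆⇒length≤ {[]} _ _ = z≤n
unique-⊆⇒length≤ {x ∷ xs} {ys} (x∉xs ∷ xs!) x∷xs⊆ys =
  ≤-trans (s≤s (unique-⊆⇒length≤ xs! xs⊆ys-x)) (filter-notAll ≢x? ys (lose (x∷xs⊆ys (here refl)) (λ x≢x → x≢x refl)))
  where
  ≢x? : Decidable (_≢ x)
  ≢x? y = ¬? (y ≟ x)
  xs⊆ys-x : xs ⊆ filter ≢x? ys
  xs⊆ys-x y∈xs = ∈-filter⁺ ≢x? (x∷xs⊆ys (there y∈xs)) (All.lookup x∉xs y∈xs ∘ sym)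

unique-⊆⇒length≤card : {xs A : FinSet} → Unique xs → xs ⊆ A → length xs ≤ card A
unique-⊆⇒length≤card xs! xs⊆A = unique-⊆⇒length≤ xs! (∈-deduplicate⁺ _≟_ ∘ xs⊆A)

card-mono : {A B : FinSet} → A ⊆ B → card A ≤ card B
card-mono {A} A⊆B = unique-⊆⇒length≤card (deduplicate-! A) (A⊆B ∘ ∈-deduplicate⁻ _≟_ A)

card-++ : (xs A : FinSet) → card (xs ++ A) ≤ length xs + card A
card-++ xs A = ≤-trans (unique-⊆⇒length≤ (deduplicate-! (xs ++ A)) ⊆xs++A') (≤-reflexive (length-++ xs))
  where
  ⊆xs++A' : deduplicate _≟_ (xs ++ A) ⊆ xs ++ deduplicate _≟_ A
  ⊆xs++A' y∈ with ∈-++⁻ xs (∈-deduplicate⁻ _≟_ (xs ++ A) y∈)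
  ... | inj₁ y∈xs = ∈-++⁺ˡ y∈xs
  ... | inj₂ y∈A = ∈-++⁺ʳ xs (∈-deduplicate⁺ _≟_ y∈A)

_∖_ : FinSet → FinSet → FinSet
A ∖ B = filter (λ x → ¬? (x ∈? B)) A

∈-∖⁺ : ∀ {x A B} → x ∈ A → x ∉ B → x ∈ A ∖ B
∈-∖⁺ {B = B} = ∈-filter⁺ (λ x → ¬? (x ∈? B))

∈-∖⁻ : ∀ {x} A B → x ∈ A ∖ B → x ∈ A × x ∉ B
∈-∖⁻ A B = ∈-filter⁻ (λ x → ¬? (x ∈? B)) {xs = A}

_∩_ : FinSet → FinSet → FinSet
A ∩ B = filter (_∈? B) A

take-++-⊆⊎⊇ : ∀ {A : Set} k (xs ys : List A) → take k (xs ++ ys) ⊆ xs ⊎ xs ⊆ take k (xs ++ ys)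
take-++-⊆⊎⊇ zero xs ys = inj₁ λ ()
take-++-⊆⊎⊇ (suc k) [] ys = inj₂ λ ()
take-++-⊆⊎⊇ (suc k) (x ∷ xs) ys with take-++-⊆⊎⊇ k xs ys
... | inj₁ ⊆xs = inj₁ λ { (here refl) → here refl ; (there p) → there (⊆xs p) }
... | inj₂ xs⊆ = inj₂ λ { (here refl) → here refl ; (there p) → there (xs⊆ p) }

length-concatMap : ∀ {A B : Set} (f : A → List B) xs → length (concatMap f xs) ≡ sum (map (length ∘ f) xs)
length-concatMap f [] = refl
length-concatMap f (x ∷ xs) = trans (length-++ (f x)) (cong (length (f x) +_) (length-concatMap f xs))

∈⇒≤sum : ∀ {A : Set} (f : A → ℕ) {x} xs → x ∈ xs → f x ≤ sum (map f xs)
∈⇒≤sum f (x ∷ xs) (here refl) = m≤m+n (f x) _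
∈⇒≤sum f (y ∷ xs) (there x∈xs) = ≤-trans (∈⇒≤sum f xs x∈xs) (m≤n+m _ (f y))

filter-map : ∀ {A B : Set} {P : B → Set} (P? : Decidable P) (f : A → B) xs →
  filter P? (map f xs) ≡ map f (filter (P? ∘ f) xs)
filter-map P? f [] = refl
filter-map P? f (x ∷ xs) with does (P? (f x))
... | true = cong (f x ∷_) (filter-map P? f xs)
... | false = filter-map P? f xs

record GreedyChoice (A B : FinSet) (k : ℕ) : Set where
  field
    chosen : FinSet
    chosen-unique : Unique chosen
    chosen⊆ : chosen ⊆ A
    length-chosen : length chosen ≡ k
    avoids⊎covers : Disjoint chosen B ⊎ A ∖ B ⊆ chosen

greedyChoice : (A B : FinSet) {k : ℕ} → k ≤ card A → GreedyChoice A B k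
greedyChoice A B {k} k≤|A| = record
  { chosen = take k E
  ; chosen-unique = take⁺ k E-unique
  ; chosen⊆ = E⊆A ∘ take⊆E
  ; length-chosen = trans (length-take k E) (m≤n⇒m⊓n≡m (≤-trans k≤|A| |A|≤|E|))
  ; avoids⊎covers = avoids⊎covers
  }
  where
  D : FinSet
  D = deduplicate _≟_ A
  E : FinSet
  E = (D ∖ B) ++ (D ∩ B)

  E-unique : Unique E
  E-unique = ++⁺ (filter⁺ _ (deduplicate-! A)) (filter⁺ _ (deduplicate-! A))
    (λ (x∈D∖B , x∈D∩B) → proj₂ (∈-∖⁻ D B x∈D∖B) (proj₂ (∈-filter⁻ (_∈? B) {xs = D} x∈D∩B)))

  E⊆A : E ⊆ A
  E⊆A x∈E with ∈-++⁻ (D ∖ B) x∈E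
  ... | inj₁ x∈D∖B = ∈-deduplicate⁻ _≟_ A (proj₁ (∈-∖⁻ D B x∈D∖B))
  ... | inj₂ x∈D∩B = ∈-deduplicate⁻ _≟_ A (proj₁ (∈-filter⁻ (_∈? B) {xs = D} x∈D∩B))

  D⊆E : D ⊆ E
  D⊆E {x} x∈D with x ∈? B
  ... | yes x∈B = ∈-++⁺ʳ (D ∖ B) (∈-filter⁺ (_∈? B) x∈D x∈B)
  ... | no x∉B = ∈-++⁺ˡ (∈-∖⁺ x∈D x∉B)

  |A|≤|E| : card A ≤ length E
  |A|≤|E| = unique-⊆⇒length≤ (deduplicate-! A) D⊆E

  take⊆E : take k E ⊆ E
  take⊆E x∈ = subst (_ ∈_) (take++drop≡id k E) (∈-++⁺ˡ x∈)

  avoids⊎covers : Disjoint (take k E) B ⊎ A ∖ B ⊆ take k E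
  avoids⊎covers with take-++-⊆⊎⊇ k (D ∖ B) (D ∩ B)
  ... | inj₁ ⊆D∖B = inj₁ λ x x∈ → proj₂ (∈-∖⁻ D B (⊆D∖B x∈))
  ... | inj₂ D∖B⊆ = inj₂ λ x∈A∖B →
    let x∈A , x∉B = ∈-∖⁻ A B x∈A∖B in D∖B⊆ (∈-∖⁺ (∈-deduplicate⁺ _≟_ x∈A) x∉B)

module _ {n : ℕ} where

  InRange : Fin (suc n) → Fin (suc n) → Fin (suc n) → Set
  InRange i j k = toℕ i ≤ toℕ k × toℕ k ≤ toℕ j

  inRange? : (i j : Fin (suc n)) → Decidable (InRange i j)
  inRange? i j k = (toℕ i ≤? toℕ k) ×-dec (toℕ k ≤? toℕ j)

  ∈-range⁺ : ∀ i j {k} → InRange i j k → k ∈ range n i j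
  ∈-range⁺ i j {k} = ∈-filter⁺ (inRange? i j) (∈-allFin k)

  ∈-range⁻ : ∀ i j {k} → k ∈ range n i j → InRange i j k
  ∈-range⁻ i j = proj₂ ∘ ∈-filter⁻ (inRange? i j) {xs = allFin (suc n)}

  union : ListAssign n → Fin (suc n) → Fin (suc n) → FinSet
  union L i j = concatMap L (range n i j)

  ∈-union⁺ : ∀ L i j {k x} → InRange i j k → x ∈ L k → x ∈ union L i j
  ∈-union⁺ L i j k∈[i,j] x∈Lk = ∈-concatMap⁺ L (lose (∈-range⁺ i j k∈[i,j]) x∈Lk)

  ∈-union⁻ : ∀ L i j {x} → x ∈ union L i j → ∃ λ k → InRange i j k × x ∈ L k
  ∈-union⁻ L i j x∈ =
    let k , k∈ , x∈Lk = find (∈-concatMap⁻ L {xs = range n i j} x∈) in k , ∈-range⁻ i j k∈ , x∈Lk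

module _ {m : ℕ} where

  private
    range-tail : (i' : Fin (suc (suc m))) (i j : Fin (suc m)) →
      (∀ {k} → InRange i' (fs j) (fs k) → InRange i j k) → (∀ {k} → InRange i j k → InRange i' (fs j) (fs k)) →
      filter (inRange? i' (fs j)) (map fs (allFin (suc m))) ≡ map fs (range m i j)
    range-tail i' i j to from =
      trans (filter-map (inRange? i' (fs j)) fs (allFin (suc m)))
            (cong (map fs) (filter-≐ (inRange? i' (fs j) ∘ fs) (inRange? i j) (to , from) (allFin (suc m))))

    allFin-suc : allFin (suc (suc m)) ≡ fz ∷ map fs (allFin (suc m))
    allFin-suc = cong (fz ∷_) (sym (map-tabulate id fs))

  range-suc : (i j : Fin (suc m)) → range (suc m) (fs i) (fs j) ≡ map fs (range m i j)
  range-suc i j = begin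
    range (suc m) (fs i) (fs j)
      ≡⟨ cong (filter (inRange? (fs i) (fs j))) allFin-suc ⟩
    filter (inRange? (fs i) (fs j)) (fz ∷ map fs (allFin (suc m)))
      ≡⟨ filter-reject (inRange? (fs i) (fs j)) {fz} {map fs (allFin (suc m))} (λ ()) ⟩
    filter (inRange? (fs i) (fs j)) (map fs (allFin (suc m)))
      ≡⟨ range-tail (fs i) i j (λ (a , b) → s≤s⁻¹ a , s≤s⁻¹ b) (λ (a , b) → s≤s a , s≤s b) ⟩
    map fs (range m i j)
      ∎
    where open ≡-Reasoning

  range-zero : (j : Fin (suc m)) → range (suc m) fz (fs j) ≡ fz ∷ map fs (range m fz j)
  range-zero j = begin
    range (suc m) fz (fs j)
      ≡⟨ cong (filter (inRange? fz (fs j))) allFin-suc ⟩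
    filter (inRange? fz (fs j)) (fz ∷ map fs (allFin (suc m)))
      ≡⟨ filter-accept (inRange? fz (fs j)) {fz} {map fs (allFin (suc m))} (z≤n , z≤n) ⟩
    fz ∷ filter (inRange? fz (fs j)) (map fs (allFin (suc m)))
      ≡⟨ cong (fz ∷_) (range-tail fz fz j (λ (_ , b) → z≤n , s≤s⁻¹ b) (λ (_ , b) → z≤n , s≤s b)) ⟩
    fz ∷ map fs (range m fz j)
      ∎
    where open ≡-Reasoning

  weightSum-suc : (w : Weight (suc m)) (i j : Fin (suc m)) → weightSum (suc m) w (fs i) (fs j) ≡ weightSum m (w ∘ fs) i j
  weightSum-suc w i j = cong sum (trans (cong (map w) (range-suc i j)) (sym (map-∘ (range m i j))))

  weightSum-zero : (w : Weight (suc m)) (j : Fin (suc m)) → weightSum (suc m) w fz (fs j) ≡ w fz + weightSum m (w ∘ fs) fz j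
  weightSum-zero w j = cong sum (trans (cong (map w) (range-zero j)) (cong (w fz ∷_) (sym (map-∘ (range m fz j)))))

  union-suc-⊆ : {L : ListAssign (suc m)} {L' : ListAssign m} {i j : Fin (suc m)} →
    (∀ k → toℕ i ≤ toℕ k → L (fs k) ⊆ L' k) → union L (fs i) (fs j) ⊆ union L' i j
  union-suc-⊆ {L} {L'} {i} {j} Lk⊆L'k x∈ with ∈-union⁻ L (fs i) (fs j) x∈
  ... | fs k , (s≤s i≤k , s≤s k≤j) , x∈Lk = ∈-union⁺ L' i j (i≤k , k≤j) (Lk⊆L'k k i≤k x∈Lk)

Hall : (n : ℕ) → ListAssign n → Weight n → Set
Hall n L w = ∀ (i j : Fin (suc n)) → toℕ i ≤ toℕ j → unionCard n L i j ≥ weightSum n w i j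

weight≤card : ∀ {n L w} → Hall n L w → ∀ k → w k ≤ card (L k)
weight≤card {n} {L} {w} hall k = begin
  w k                 ≤⟨ ∈⇒≤sum w (range n k k) (∈-range⁺ k k (≤-refl , ≤-refl)) ⟩
  weightSum n w k k   ≤⟨ hall k k ≤-refl ⟩
  unionCard n L k k   ≤⟨ card-mono union⊆Lk ⟩
  card (L k)          ∎
  where
  open ≤-Reasoning
  union⊆Lk : union L k k ⊆ L k
  union⊆Lk x∈ with ∈-union⁻ L k k x∈
  ... | k' , (k≤k' , k'≤k) , x∈Lk' = subst (λ v → _ ∈ L v) (toℕ-injective (≤-antisym k'≤k k≤k')) x∈Lk'

data Gap (a b : ℕ) : Set where
  same : a ≡ b → Gap a b
  before : suc a ≡ b → Gap a b
  after : suc b ≡ a → Gap a b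
  far : 2 ≤ ∣ a - b ∣ → Gap a b

gap : ∀ a b → Gap a b
gap zero zero = same refl
gap zero (suc zero) = before refl
gap zero (suc (suc b)) = far (s≤s (s≤s z≤n))
gap (suc zero) zero = after refl
gap (suc (suc a)) zero = far (s≤s (s≤s z≤n))
gap (suc a) (suc b) with gap a b
... | same a≡b = same (cong suc a≡b)
... | before 1+a≡b = before (cong suc 1+a≡b)
... | after 1+b≡a = after (cong suc 1+b≡a)
... | far 2≤∣a-b∣ = far 2≤∣a-b∣

module _ {n : ℕ} {L : ListAssign n} {w : Weight n} {c : Fin (suc n) → FinSet} where

  adjacent-disjoint : IsColoring n L w c → ∀ {k k'} → suc (toℕ k) ≡ toℕ k' → Disjoint (c k) (c k')
  adjacent-disjoint (_ , _ , _ , edges) {k} {fs e} 1+k≡1+e =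
    subst (λ v → Disjoint (c v) (c (fs e))) (toℕ-injective (trans (toℕ-inject₁ e) (suc-injective (sym 1+k≡1+e)))) (edges e)

  coloring-disjoint : Waterfall n L → IsColoring n L w c → ∀ {k k'} → k ≢ k' → Disjoint (c k) (c k')
  coloring-disjoint W col@(c⊆L , _) {k} {k'} k≢k' x x∈ck x∈ck' with gap (toℕ k) (toℕ k')
  ... | same k≡k' = k≢k' (toℕ-injective k≡k')
  ... | before 1+k≡k' = adjacent-disjoint col 1+k≡k' x x∈ck x∈ck'
  ... | after 1+k'≡k = adjacent-disjoint col 1+k'≡k x x∈ck' x∈ck
  ... | far 2≤∣k-k'∣ = W k k' 2≤∣k-k'∣ x (All.lookup (c⊆L k) x∈ck) (All.lookup (c⊆L k') x∈ck')

colorable⇒hall : ∀ {n L w} → Waterfall n L → PathColorable n L w → Hall n L w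
colorable⇒hall {n} {L} {w} W (c , col@(c⊆L , c-unique , length-c , _)) i j _ = begin
  weightSum n w i j          ≡⟨ cong sum (map-cong (sym ∘ length-c) R) ⟩
  sum (map (length ∘ c) R)   ≡⟨ sym (length-concatMap c R) ⟩
  length (concatMap c R)     ≤⟨ unique-⊆⇒length≤card colours-unique colours⊆union ⟩
  unionCard n L i j          ∎
  where
  open ≤-Reasoning
  R : List (Fin (suc n))
  R = range n i j
  colours-unique : Unique (concatMap c R)
  colours-unique = concat⁺ (Allₚ.map⁺ (All.tabulate λ {k} _ → c-unique k))
    (AllPairsₚ.map⁺ (AllPairs.map (λ k≢k' {x} (x∈ck , x∈ck') → coloring-disjoint W col k≢k' x x∈ck x∈ck')
                                  (filter⁺ (inRange? i j) (allFin⁺ (suc n)))))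
  colours⊆union : concatMap c R ⊆ union L i j
  colours⊆union x∈ =
    let k , k∈R , x∈ck = find (∈-concatMap⁻ c {xs = R} x∈) in ∈-union⁺ L i j (∈-range⁻ i j k∈R) (All.lookup (c⊆L k) x∈ck)

residual : ∀ {m} → FinSet → ListAssign (suc m) → ListAssign m
residual c₀ L fz = L (fs fz) ∖ c₀
residual c₀ L (fs k) = L (fs (fs k))

module _ {m : ℕ} (c₀ : FinSet) (L : ListAssign (suc m)) where

  residual⊆ : ∀ k → residual c₀ L k ⊆ L (fs k)
  residual⊆ fz = proj₁ ∘ ∈-∖⁻ (L (fs fz)) c₀
  residual⊆ (fs k) = id

  ⊆residual : ∀ k {x} → x ∈ L (fs k) → x ∉ c₀ → x ∈ residual c₀ L k
  ⊆residual fz x∈L₁ x∉c₀ = ∈-∖⁺ x∈L₁ x∉c₀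
  ⊆residual (fs k) x∈Lk _ = x∈Lk

module _ {m : ℕ} {L : ListAssign (suc m)} {w : Weight (suc m)} (hall : Hall (suc m) L w) (c₀ : FinSet) where

  private
    L' : ListAssign m
    L' = residual c₀ L

  hall-residual-shifted : ∀ i j → toℕ i ≤ toℕ j → (∀ k → toℕ i ≤ toℕ k → L (fs k) ⊆ L' k) →
    weightSum m (w ∘ fs) i j ≤ unionCard m L' i j
  hall-residual-shifted i j i≤j Lk⊆L'k = begin
    weightSum m (w ∘ fs) i j            ≡⟨ sym (weightSum-suc w i j) ⟩
    weightSum (suc m) w (fs i) (fs j)   ≤⟨ hall (fs i) (fs j) (s≤s i≤j) ⟩
    unionCard (suc m) L (fs i) (fs j)   ≤⟨ card-mono (union-suc-⊆ {L = L} {L'} {i} {j} Lk⊆L'k) ⟩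
    unionCard m L' i j                  ∎
    where open ≤-Reasoning

  hall-residual-covered : L fz ∖ L (fs fz) ⊆ c₀ → length c₀ ≡ w fz → ∀ j →
    weightSum m (w ∘ fs) fz j ≤ unionCard m L' fz j
  hall-residual-covered covers |c₀|≡w₀ j = +-cancelˡ-≤ (w fz) _ _ (begin
    w fz + weightSum m (w ∘ fs) fz j    ≡⟨ sym (weightSum-zero w j) ⟩
    weightSum (suc m) w fz (fs j)       ≤⟨ hall fz (fs j) z≤n ⟩
    unionCard (suc m) L fz (fs j)       ≤⟨ card-mono union⊆ ⟩
    card (c₀ ++ union L' fz j)          ≤⟨ card-++ c₀ (union L' fz j) ⟩
    length c₀ + unionCard m L' fz j     ≡⟨ cong (_+ unionCard m L' fz j) |c₀|≡w₀ ⟩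
    w fz + unionCard m L' fz j          ∎)
    where
    open ≤-Reasoning
    union⊆ : union L fz (fs j) ⊆ c₀ ++ union L' fz j
    union⊆ {x} x∈ with x ∈? c₀ | ∈-union⁻ L fz (fs j) x∈
    ... | yes x∈c₀ | _ = ∈-++⁺ˡ x∈c₀
    ... | no x∉c₀ | fz , _ , x∈L₀ = ∈-++⁺ʳ c₀ (∈-union⁺ L' fz j (z≤n , z≤n) (⊆residual c₀ L fz x∈L₁ x∉c₀))
      where
      x∈L₁ : x ∈ L (fs fz)
      x∈L₁ = decidable-stable (x ∈? L (fs fz)) (λ x∉L₁ → x∉c₀ (covers (∈-∖⁺ x∈L₀ x∉L₁)))
    ... | no x∉c₀ | fs k , (_ , s≤s k≤j) , x∈Lk = ∈-++⁺ʳ c₀ (∈-union⁺ L' fz j (z≤n , k≤j) (⊆residual c₀ L k x∈Lk x∉c₀))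

hall-residual : ∀ {m L w} → Hall (suc m) L w → (g : GreedyChoice (L fz) (L (fs fz)) (w fz)) →
  Hall m (residual (GreedyChoice.chosen g) L) (w ∘ fs)
hall-residual {m} {L} {w} hall g = hall'
  where
  open GreedyChoice g
  hall' : Hall m (residual chosen L) (w ∘ fs)
  hall' (fs a) j a≤j = hall-residual-shifted hall chosen (fs a) j a≤j λ { (fs k) _ → id }
  hall' fz j _ with avoids⊎covers
  ... | inj₁ avoids = hall-residual-shifted hall chosen fz j z≤n
    λ { fz _ x∈L₁ → ⊆residual chosen L fz x∈L₁ (λ x∈c₀ → avoids _ x∈c₀ x∈L₁) ; (fs k) _ → id }
  ... | inj₂ covers = hall-residual-covered hall chosen covers length-chosen j

extend-coloring : ∀ {m L w c₀} → Unique c₀ → c₀ ⊆ L fz → length c₀ ≡ w fz →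
  PathColorable m (residual c₀ L) (w ∘ fs) → PathColorable (suc m) L w
extend-coloring {m} {L} {w} {c₀} c₀! c₀⊆L₀ |c₀|≡w₀ (c' , c'⊆L' , c'! , |c'|≡w' , edges') = c , c⊆L , c! , |c|≡w , edges
  where
  c : Fin (suc (suc m)) → FinSet
  c fz = c₀
  c (fs k) = c' k
  c⊆L : ∀ v → All (_∈ L v) (c v)
  c⊆L fz = All.tabulate c₀⊆L₀
  c⊆L (fs k) = All.map (residual⊆ c₀ L k) (c'⊆L' k)
  c! : ∀ v → Unique (c v)
  c! fz = c₀!
  c! (fs k) = c'! k
  |c|≡w : ∀ v → length (c v) ≡ w v
  |c|≡w fz = |c₀|≡w₀
  |c|≡w (fs k) = |c'|≡w' k
  edges : ∀ e → Disjoint (c (inject₁ e)) (c (fs e))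
  edges fz x x∈c₀ x∈c'₀ = proj₂ (∈-∖⁻ (L (fs fz)) c₀ (All.lookup (c'⊆L' fz) x∈c'₀)) x∈c₀
  edges (fs e) = edges' e

hall⇒colorable : ∀ n {L w} → Hall n L w → PathColorable n L w
hall⇒colorable zero {L} hall =
  (λ _ → chosen) , (λ { fz → All.tabulate chosen⊆ }) , (λ { fz → chosen-unique }) , (λ { fz → length-chosen }) , λ ()
  where open GreedyChoice (greedyChoice (L fz) [] (weight≤card hall fz))
hall⇒colorable (suc m) {L} {w} hall =
  extend-coloring chosen-unique chosen⊆ length-chosen (hall⇒colorable m (hall-residual hall g))
  where
  g : GreedyChoice (L fz) (L (fs fz)) (w fz)
  g = greedyChoice (L fz) (L (fs fz)) (weight≤card hall fz)
  open GreedyChoice g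

theorem2 : (n : ℕ) (w : Weight n) (L : ListAssign n) → Waterfall n L →
    PathColorable n L w ⇔
      (∀ (i j : Fin (suc n)) → toℕ i ≤ toℕ j → unionCard n L i j ≥ weightSum n w i j)
theorem2 n w L waterfall = mk⇔ (colorable⇒hall waterfall) (hall⇒colorable n)
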